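{- Let $G$ be an edge-colored graph. Then $G$ contains a spanning bipartite subgraph $H$ such that $2d_{H}^{c}(v)+3d_{H}(v)\geq d_G^{c}(v)+d_G(v)$ for every vertex $v\in V(H)$.
   Context: Graphs are finite and simple. An edge-colored graph is a graph $G$ with a map $C:E(G)\to\mathbb{N}$; subgraphs inherit the coloring. For a subgraph $H$ and $v\in V(H)$, $d_H(v)$ is the degree of $v$ in $H$ and $d_H^c(v)$ is the number of distinct colors on edges of $H$ incident to $v$. -}

module Defs where

open import Data.Nat using (ℕ; _≟_)
open import Data.Bool using (Bool; true; false)
open import Data.Fin using (Fin)
open import Data.List using (List; length; map; filterᵇ; deduplicate; allFin)
open import Data.Product using (Σ; _×_)
open import Relation.Binary.PropositionalEquality using (_≡_; _≢_)

record Graph (n : ℕ) : Set where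
  field
    adj    : Fin n → Fin n → Bool
    sym    : ∀ u v → adj u v ≡ adj v u
    irrefl : ∀ v → adj v v ≡ false
open Graph public

-- An edge colouring: a colour for every (unordered) pair, symmetric, so
-- that every edge uv gets a single well-defined colour C u v = C v u.
-- (Values on non-edges are irrelevant.)
record EdgeColoring (n : ℕ) : Set where
  field
    col    : Fin n → Fin n → ℕ
    colSym : ∀ u v → col u v ≡ col v u
open EdgeColoring public

nbrs : ∀ {n} → Graph n → Fin n → List (Fin n)
nbrs G v = filterᵇ (adj G v) (allFin _)

deg : ∀ {n} → Graph n → Fin n → ℕ
deg G v = length (nbrs G v)

colDeg : ∀ {n} → Graph n → EdgeColoring n → Fin n → ℕ
colDeg G C v = length (deduplicate _≟_ (map (col C v) (nbrs G v)))

SpanningSubgraph : ∀ {n} → Graph n → Graph n → Set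
SpanningSubgraph H G = ∀ u v → adj H u v ≡ true → adj G u v ≡ true

Bipartite : ∀ {n} → Graph n → Set
Bipartite {n} H = Σ (Fin n → Bool) λ side →
  ∀ u v → adj H u v ≡ true → side u ≢ side v

-- Choose a bipartition of V(G) that is locally maximal: moving a single vertex w
-- to the other side, which changes the number of crossing edges by u(w) − c(w)
-- (non-crossing minus crossing edges at w), never increases it.  It exists by
-- hill climbing, as the number of crossing edges is bounded.  Let H consist of
-- the crossing edges, so c = d_H and u ≤ d_H.  At every vertex v,
-- d_G(v) = d_H(v) + u(v), and each colour at v appears in H or on one of the u(v)
-- non-crossing edges, so d^c_G(v) ≤ d^c_H(v) + u(v).  Adding,
-- d^c_G(v) + d_G(v) ≤ d^c_H(v) + 2 u(v) + d_H(v) ≤ d^c_H(v) + 3 d_H(v).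

module Submission where

open import Data.Bool using (Bool; true; false; not; _∧_; _xor_)
open import Data.Bool.Properties using (xor-comm; xor-same; ∧-zeroʳ)
open import Data.Fin using (Fin; zero; suc)
open import Data.Fin.Properties using (_≟_; all?; ¬∀⟶∃¬)
open import Data.List using (List; []; _∷_; length; map; filter; filterᵇ; deduplicate; tabulate; allFin)
open import Data.List.Properties
  using (length-filter; length-map; filter-accept; filter-reject; filter-≐; filter-all)
open import Data.List.Relation.Unary.All using (universal)
import Data.List.Relation.Ternary.Interleaving as Interleaving
open import Data.List.Relation.Ternary.Interleaving.Propositional using (Interleaving; consˡ; consʳ; [])
open import Data.List.Relation.Ternary.Interleaving.Properties using (interleave-length; map⁺)
open import Data.Nat using (ℕ; zero; suc; _+_; _*_; _≤_; _<_; _≤?_; z≤n; s≤s)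
import Data.Nat as ℕ
open import Data.Nat.Properties
  using ( +-*-semiring; +-identityʳ; *-identityˡ; *-identityʳ; *-distribʳ-+; +-suc
        ; ≤-reflexive; ≤-trans; <-≤-trans; <⇒≱; ≰⇒>; n≤1+n; m≤m+n; m≤n+m
        ; +-mono-≤; +-monoˡ-≤; +-monoʳ-≤; +-mono-<; +-monoʳ-<; +-cancelʳ-<; module ≤-Reasoning )
open import Algebra.Properties.Semiring.Sum +-*-semiring
  using (sum; sum-syntax; ∑-distrib-+; sum-cong-≗; sum-replicate-zero; *-distribˡ-sum)
open import Data.Nat.Tactic.RingSolver using (solve-∀)
open import Data.Product using (Σ; _×_; _,_; proj₁; proj₂; swap)
open import Data.Sum using (_⊎_; inj₁; inj₂)
open import Function using (_∘_; id)
open import Level using (Level)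
open import Relation.Binary.Definitions using (DecidableEquality)
open import Relation.Binary.PropositionalEquality
  using (_≡_; refl; cong; cong₂; sym; trans; subst; subst₂; module ≡-Reasoning)
open import Relation.Nullary using (Dec; yes; no; does; ¬?; ¬_; contradiction)
open import Relation.Unary using (Pred; Decidable; _⊆_)
open import Relation.Unary.Properties using (_∩?_; U?)

open import Defs hiding (sym)

private variable
  a p q ℓ : Level
  A : Set a

filter-filter : {P : Pred A p} {Q : Pred A q} (P? : Decidable P) (Q? : Decidable Q) →
                ∀ xs → filter P? (filter Q? xs) ≡ filter (P? ∩? Q?) xs
filter-filter P? Q? [] = refl
filter-filter {P = P} {Q} P? Q? (x ∷ xs) = by-cases (P? x) (Q? x)
  where
  open ≡-Reasoning
  by-cases : Dec (P x) → Dec (Q x) → filter P? (filter Q? (x ∷ xs)) ≡ filter (P? ∩? Q?) (x ∷ xs)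
  by-cases (yes px) (yes qx) = begin
    filter P? (filter Q? (x ∷ xs)) ≡⟨ cong (filter P?) (filter-accept Q? qx) ⟩
    filter P? (x ∷ filter Q? xs)   ≡⟨ filter-accept P? px ⟩
    x ∷ filter P? (filter Q? xs)   ≡⟨ cong (x ∷_) (filter-filter P? Q? xs) ⟩
    x ∷ filter (P? ∩? Q?) xs       ≡⟨ filter-accept (P? ∩? Q?) (px , qx) ⟨
    filter (P? ∩? Q?) (x ∷ xs)     ∎
  by-cases (no ¬px) (yes qx) = begin
    filter P? (filter Q? (x ∷ xs)) ≡⟨ cong (filter P?) (filter-accept Q? qx) ⟩
    filter P? (x ∷ filter Q? xs)   ≡⟨ filter-reject P? ¬px ⟩
    filter P? (filter Q? xs)       ≡⟨ filter-filter P? Q? xs ⟩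
    filter (P? ∩? Q?) xs           ≡⟨ filter-reject (P? ∩? Q?) (¬px ∘ proj₁) ⟨
    filter (P? ∩? Q?) (x ∷ xs)     ∎
  by-cases _ (no ¬qx) = begin
    filter P? (filter Q? (x ∷ xs)) ≡⟨ cong (filter P?) (filter-reject Q? ¬qx) ⟩
    filter P? (filter Q? xs)       ≡⟨ filter-filter P? Q? xs ⟩
    filter (P? ∩? Q?) xs           ≡⟨ filter-reject (P? ∩? Q?) (¬qx ∘ proj₂) ⟨
    filter (P? ∩? Q?) (x ∷ xs)     ∎

filter-comm : {P : Pred A p} {Q : Pred A q} (P? : Decidable P) (Q? : Decidable Q) →
              ∀ xs → filter P? (filter Q? xs) ≡ filter Q? (filter P? xs)
filter-comm P? Q? xs = begin
  filter P? (filter Q? xs) ≡⟨ filter-filter P? Q? xs ⟩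
  filter (P? ∩? Q?) xs     ≡⟨ filter-≐ (P? ∩? Q?) (Q? ∩? P?) (swap , swap) xs ⟩
  filter (Q? ∩? P?) xs     ≡⟨ filter-filter Q? P? xs ⟨
  filter Q? (filter P? xs) ∎
  where open ≡-Reasoning

filter-⊆ : {P : Pred A p} {Q : Pred A q} (P? : Decidable P) (Q? : Decidable Q) → P ⊆ Q →
           ∀ xs → filter P? (filter Q? xs) ≡ filter P? xs
filter-⊆ P? Q? P⊆Q xs =
  trans (filter-filter P? Q? xs) (filter-≐ (P? ∩? Q?) P? (proj₁ , λ px → px , P⊆Q px) xs)

module _ (_≟_ : DecidableEquality A) where

  private
    _≢?_ : (x y : A) → Dec (¬ x ≡ y)
    x ≢? y = ¬? (x ≟ y)

  distinct : List A → ℕ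
  distinct xs = length (deduplicate _≟_ xs)

  filter-deduplicate : {P : Pred A p} (P? : Decidable P) →
                       ∀ xs → filter P? (deduplicate _≟_ xs) ≡ deduplicate _≟_ (filter P? xs)
  filter-deduplicate P? [] = refl
  filter-deduplicate {P = P} P? (x ∷ xs) = by-cases (P? x)
    where
    open ≡-Reasoning
    ys = deduplicate _≟_ xs
    by-cases : Dec (P x) → filter P? (deduplicate _≟_ (x ∷ xs)) ≡ deduplicate _≟_ (filter P? (x ∷ xs))
    by-cases (yes px) = begin
      filter P? (x ∷ filter (x ≢?_) ys)     ≡⟨ filter-accept P? px ⟩
      x ∷ filter P? (filter (x ≢?_) ys)     ≡⟨ cong (x ∷_) (filter-comm P? (x ≢?_) ys) ⟩
      x ∷ filter (x ≢?_) (filter P? ys)     ≡⟨ cong (λ zs → x ∷ filter (x ≢?_) zs) (filter-deduplicate P? xs) ⟩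
      deduplicate _≟_ (x ∷ filter P? xs)    ≡⟨ cong (deduplicate _≟_) (filter-accept P? px) ⟨
      deduplicate _≟_ (filter P? (x ∷ xs))  ∎
    by-cases (no ¬px) = begin
      filter P? (x ∷ filter (x ≢?_) ys)     ≡⟨ filter-reject P? ¬px ⟩
      filter P? (filter (x ≢?_) ys)         ≡⟨ filter-⊆ P? (x ≢?_) P⊆x≢ ys ⟩
      filter P? ys                          ≡⟨ filter-deduplicate P? xs ⟩
      deduplicate _≟_ (filter P? xs)        ≡⟨ cong (deduplicate _≟_) (filter-reject P? ¬px) ⟨
      deduplicate _≟_ (filter P? (x ∷ xs))  ∎
      where
      P⊆x≢ : P ⊆ (λ y → ¬ x ≡ y)
      P⊆x≢ py x≡y = ¬px (subst P (sym x≡y) py)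

  distinct-∷ : ∀ x xs → distinct (x ∷ xs) ≡ suc (distinct (filter (x ≢?_) xs))
  distinct-∷ x xs = cong (suc ∘ length) (filter-deduplicate (x ≢?_) xs)

  distinct-∷-≤ : ∀ x xs → distinct (x ∷ xs) ≤ suc (distinct xs)
  distinct-∷-≤ x xs = s≤s (length-filter (x ≢?_) (deduplicate _≟_ xs))

  distinct-filter-interleaving : {P : Pred A p} (P? : Decidable P) → ∀ {xs ys zs} →
    Interleaving ys zs xs → distinct (filter P? xs) ≤ distinct (filter P? ys) + length zs
  distinct-filter-interleaving P? [] = z≤n
  distinct-filter-interleaving {P = P} P? {y ∷ xs} {y ∷ ys} {zs} (consˡ sp) with P? y
  ... | no _ = distinct-filter-interleaving P? sp
  ... | yes _ = begin
    distinct (y ∷ filter P? xs)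
      ≡⟨ distinct-∷ y (filter P? xs) ⟩
    suc (distinct (filter (y ≢?_) (filter P? xs)))
      ≡⟨ cong (suc ∘ distinct) (filter-filter (y ≢?_) P? xs) ⟩
    suc (distinct (filter ((y ≢?_) ∩? P?) xs))
      ≤⟨ s≤s (distinct-filter-interleaving ((y ≢?_) ∩? P?) sp) ⟩
    suc (distinct (filter ((y ≢?_) ∩? P?) ys) + length zs)
      ≡⟨ cong (λ ws → suc (distinct ws) + length zs) (filter-filter (y ≢?_) P? ys) ⟨
    suc (distinct (filter (y ≢?_) (filter P? ys))) + length zs
      ≡⟨ cong (_+ length zs) (distinct-∷ y (filter P? ys)) ⟨
    distinct (y ∷ filter P? ys) + length zs
      ∎
    where open ≤-Reasoning
  distinct-filter-interleaving P? {z ∷ xs} {ys} {z ∷ zs} (consʳ sp) with P? z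
  ... | no _ = ≤-trans (distinct-filter-interleaving P? sp) (+-monoʳ-≤ _ (n≤1+n (length zs)))
  ... | yes _ = begin
    distinct (z ∷ filter P? xs)                ≤⟨ distinct-∷-≤ z (filter P? xs) ⟩
    suc (distinct (filter P? xs))              ≤⟨ s≤s (distinct-filter-interleaving P? sp) ⟩
    suc (distinct (filter P? ys) + length zs)  ≡⟨ +-suc _ (length zs) ⟨
    distinct (filter P? ys) + length (z ∷ zs)  ∎
    where open ≤-Reasoning

  distinct-interleaving : ∀ {xs ys zs} →
    Interleaving ys zs xs → distinct xs ≤ distinct ys + length zs
  distinct-interleaving {xs} {ys} sp =
    subst₂ (λ xs′ ys′ → distinct xs′ ≤ distinct ys′ + _)
      (filter-all U? (universal _ xs)) (filter-all U? (universal _ ys))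
      (distinct-filter-interleaving U? sp)

filterᵇ-split : (p q : A → Bool) → ∀ xs →
  Interleaving (filterᵇ (λ x → p x ∧ q x) xs) (filterᵇ (λ x → p x ∧ not (q x)) xs) (filterᵇ p xs)
filterᵇ-split p q [] = []
filterᵇ-split p q (x ∷ xs) with p x | q x
... | true  | true  = consˡ (filterᵇ-split p q xs)
... | true  | false = consʳ (filterᵇ-split p q xs)
... | false | _     = filterᵇ-split p q xs

⟦_⟧ : Bool → ℕ
⟦ true ⟧  = 1
⟦ false ⟧ = 0

length-filterᵇ-tabulate : ∀ {n} (p : A → Bool) (f : Fin n → A) →
                          length (filterᵇ p (tabulate f)) ≡ ∑[ i < n ] ⟦ p (f i) ⟧
length-filterᵇ-tabulate {n = zero} p f = refl
length-filterᵇ-tabulate {n = suc n} p f with p (f zero)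
... | true  = cong suc (length-filterᵇ-tabulate p (f ∘ suc))
... | false = length-filterᵇ-tabulate p (f ∘ suc)

∑-select : ∀ {n} (w : Fin n) (g : Fin n → ℕ) → ∑[ u < n ] (⟦ does (u ≟ w) ⟧ * g u) ≡ g w
∑-select {suc n} zero g =
  trans (cong₂ _+_ (*-identityˡ (g zero)) (sum-replicate-zero n)) (+-identityʳ (g zero))
∑-select {suc n} (suc w) g = ∑-select w (g ∘ suc)

∑∑-incident : ∀ {n} (F : Fin n → Fin n → ℕ) → (∀ u v → F u v ≡ F v u) → ∀ w →
  ∑[ u < n ] ∑[ v < n ] ((⟦ does (u ≟ w) ⟧ + ⟦ does (v ≟ w) ⟧) * F u v) ≡ sum (F w) + sum (F w)
∑∑-incident {n} F F-sym w = begin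
  ∑[ u < n ] ∑[ v < n ] ((δ u + δ v) * F u v)
    ≡⟨ sum-cong-≗ {n} (λ u → trans (sum-cong-≗ {n} (λ v → *-distribʳ-+ (F u v) (δ u) (δ v)))
                                   (∑-distrib-+ {n} _ _)) ⟩
  ∑[ u < n ] (∑[ v < n ] (δ u * F u v) + ∑[ v < n ] (δ v * F u v))
    ≡⟨ ∑-distrib-+ {n} _ _ ⟩
  ∑[ u < n ] ∑[ v < n ] (δ u * F u v) + ∑[ u < n ] ∑[ v < n ] (δ v * F u v)
    ≡⟨ cong₂ _+_ (trans (sum-cong-≗ {n} (λ u → sym (*-distribˡ-sum (δ u) (F u))))
                        (∑-select w (sum ∘ F)))
                 (sum-cong-≗ {n} (λ u → trans (∑-select w (F u)) (F-sym u w))) ⟩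
  sum (F w) + sum (F w) ∎
  where
  open ≡-Reasoning
  δ : Fin n → ℕ
  δ u = ⟦ does (u ≟ w) ⟧

∑-bound : ∀ {n} c (f : Fin n → ℕ) → (∀ i → f i ≤ c) → sum f ≤ n * c
∑-bound {zero} c f f≤c = z≤n
∑-bound {suc n} c f f≤c = +-mono-≤ (f≤c zero) (∑-bound c (f ∘ suc) (f≤c ∘ suc))

⟦⟧≤1 : ∀ b → ⟦ b ⟧ ≤ 1
⟦⟧≤1 true  = s≤s z≤n
⟦⟧≤1 false = z≤n

hill-climb : {S : Set a} (f : S → ℕ) (b : ℕ) → (∀ s → f s ≤ b) →
             {Q : Pred S ℓ} → (∀ s → Q s ⊎ Σ S (λ s′ → f s < f s′)) → S → Σ S Q
hill-climb {S = S} f b f≤b {Q} step s₀ = climb (suc b) s₀ (m≤n+m (suc b) (f s₀))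
  where
  climb : ∀ k s → b < f s + k → Σ S Q
  climb zero s b<fs = contradiction (f≤b s) (<⇒≱ (subst (b <_) (+-identityʳ (f s)) b<fs))
  climb (suc k) s b<fs+1+k with step s
  ... | inj₁ qs = s , qs
  ... | inj₂ (s′ , fs<fs′) =
    climb k s′ (<-≤-trans b<fs+1+k (≤-trans (≤-reflexive (+-suc (f s) k)) (+-monoˡ-≤ k fs<fs′)))

-- d and e record whether u and v are the switched vertex; the hypothesis rules
-- out a loop at it.
switch-pointwise : ∀ a x y d e → d ∧ e ∧ a ≡ false →
  ⟦ a ∧ ((x xor d) xor (y xor e)) ⟧ + (⟦ d ⟧ + ⟦ e ⟧) * ⟦ a ∧ (x xor y) ⟧
    ≡ ⟦ a ∧ (x xor y) ⟧ + (⟦ d ⟧ + ⟦ e ⟧) * ⟦ a ∧ not (x xor y) ⟧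
switch-pointwise false _     _     _     _     _  = refl
switch-pointwise true  _     _     true  true  ()
switch-pointwise true  true  true  true  false _  = refl
switch-pointwise true  true  false true  false _  = refl
switch-pointwise true  false true  true  false _  = refl
switch-pointwise true  false false true  false _  = refl
switch-pointwise true  true  true  false true  _  = refl
switch-pointwise true  true  false false true  _  = refl
switch-pointwise true  false true  false true  _  = refl
switch-pointwise true  false false false true  _  = refl
switch-pointwise true  true  true  false false _  = refl
switch-pointwise true  true  false false false _  = refl
switch-pointwise true  false true  false false _  = refl
switch-pointwise true  false false false false _  = refl

degree-arithmetic : ∀ {cG cH a b} → cG ≤ cH + b → b ≤ a → cG + (a + b) ≤ 2 * cH + 3 * a
degree-arithmetic {cG} {cH} {a} {b} cG≤cH+b b≤a = begin
  cG + (a + b)           ≤⟨ +-monoˡ-≤ (a + b) cG≤cH+b ⟩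
  cH + b + (a + b)       ≤⟨ +-mono-≤ (+-monoʳ-≤ cH b≤a) (+-monoʳ-≤ a b≤a) ⟩
  cH + a + (a + a)       ≤⟨ m≤m+n (cH + a + (a + a)) cH ⟩
  cH + a + (a + a) + cH  ≡⟨ rearrange cH a ⟩
  2 * cH + 3 * a         ∎
  where
  open ≤-Reasoning
  rearrange : ∀ c a → c + a + (a + a) + c ≡ 2 * c + 3 * a
  rearrange = solve-∀

module Cut {n : ℕ} (G : Graph n) where

  crossing : (Fin n → Bool) → Fin n → Fin n → Bool
  crossing s u v = adj G u v ∧ (s u xor s v)

  uncut : (Fin n → Bool) → Fin n → Fin n → Bool
  uncut s u v = adj G u v ∧ not (s u xor s v)

  cutDeg : (Fin n → Bool) → Fin n → ℕ
  cutDeg s u = ∑[ v < n ] ⟦ crossing s u v ⟧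

  uncutDeg : (Fin n → Bool) → Fin n → ℕ
  uncutDeg s u = ∑[ v < n ] ⟦ uncut s u v ⟧

  cutWeight : (Fin n → Bool) → ℕ
  cutWeight s = ∑[ u < n ] cutDeg s u

  switch : (Fin n → Bool) → Fin n → Fin n → Bool
  switch s w u = s u xor does (u ≟ w)

  crossing-sym : ∀ s u v → ⟦ crossing s u v ⟧ ≡ ⟦ crossing s v u ⟧
  crossing-sym s u v = cong ⟦_⟧ (cong₂ _∧_ (Graph.sym G u v) (xor-comm (s u) (s v)))

  uncut-sym : ∀ s u v → ⟦ uncut s u v ⟧ ≡ ⟦ uncut s v u ⟧
  uncut-sym s u v = cong ⟦_⟧ (cong₂ _∧_ (Graph.sym G u v) (cong not (xor-comm (s u) (s v))))

  switch-crossing : ∀ s w u v →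
    ⟦ crossing (switch s w) u v ⟧ + (⟦ does (u ≟ w) ⟧ + ⟦ does (v ≟ w) ⟧) * ⟦ crossing s u v ⟧
      ≡ ⟦ crossing s u v ⟧ + (⟦ does (u ≟ w) ⟧ + ⟦ does (v ≟ w) ⟧) * ⟦ uncut s u v ⟧
  switch-crossing s w u v = switch-pointwise (adj G u v) (s u) (s v) _ _ (no-loop (u ≟ w) (v ≟ w))
    where
    no-loop : (u≟w : Dec (u ≡ w)) (v≟w : Dec (v ≡ w)) → does u≟w ∧ does v≟w ∧ adj G u v ≡ false
    no-loop (yes refl) (yes refl) = irrefl G w
    no-loop (yes _)    (no _)     = refl
    no-loop (no _)     _          = refl

  -- cutWeight changes by 2 (uncutDeg − cutDeg), stated without subtraction.
  switch-cutWeight : ∀ s w →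
    cutWeight (switch s w) + (cutDeg s w + cutDeg s w) ≡ cutWeight s + (uncutDeg s w + uncutDeg s w)
  switch-cutWeight s w = begin
    cutWeight (switch s w) + (cutDeg s w + cutDeg s w)
      ≡⟨ cong (cutWeight (switch s w) +_) (∑∑-incident _ (crossing-sym s) w) ⟨
    cutWeight (switch s w) + ∑[ u < n ] ∑[ v < n ] (δ u v * ⟦ crossing s u v ⟧)
      ≡⟨ ∑∑-distrib-+ _ _ ⟨
    ∑[ u < n ] ∑[ v < n ] (⟦ crossing (switch s w) u v ⟧ + δ u v * ⟦ crossing s u v ⟧)
      ≡⟨ sum-cong-≗ {n} (λ u → sum-cong-≗ {n} (switch-crossing s w u)) ⟩
    ∑[ u < n ] ∑[ v < n ] (⟦ crossing s u v ⟧ + δ u v * ⟦ uncut s u v ⟧)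
      ≡⟨ ∑∑-distrib-+ _ _ ⟩
    cutWeight s + ∑[ u < n ] ∑[ v < n ] (δ u v * ⟦ uncut s u v ⟧)
      ≡⟨ cong (cutWeight s +_) (∑∑-incident _ (uncut-sym s) w) ⟩
    cutWeight s + (uncutDeg s w + uncutDeg s w) ∎
    where
    open ≡-Reasoning
    δ : Fin n → Fin n → ℕ
    δ u v = ⟦ does (u ≟ w) ⟧ + ⟦ does (v ≟ w) ⟧
    ∑∑-distrib-+ : (F F′ : Fin n → Fin n → ℕ) →
      ∑[ u < n ] ∑[ v < n ] (F u v + F′ u v) ≡ ∑[ u < n ] ∑[ v < n ] F u v + ∑[ u < n ] ∑[ v < n ] F′ u v
    ∑∑-distrib-+ F F′ = trans (sum-cong-≗ {n} (λ u → ∑-distrib-+ {n} (F u) (F′ u))) (∑-distrib-+ {n} _ _)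

  cutWeight-≤ : ∀ s → cutWeight s ≤ n * n
  cutWeight-≤ s = ∑-bound n (cutDeg s) λ u →
    ≤-trans (∑-bound 1 (⟦_⟧ ∘ crossing s u) (⟦⟧≤1 ∘ crossing s u)) (≤-reflexive (*-identityʳ n))

  switch-increases-cutWeight : ∀ s w → cutDeg s w < uncutDeg s w → cutWeight s < cutWeight (switch s w)
  switch-increases-cutWeight s w cut<uncut =
    +-cancelʳ-< (cutDeg s w + cutDeg s w) (cutWeight s) (cutWeight (switch s w))
    (subst (cutWeight s + (cutDeg s w + cutDeg s w) <_) (sym (switch-cutWeight s w))
      (+-monoʳ-< (cutWeight s) (+-mono-< cut<uncut cut<uncut)))

  LocallyMaximal : (Fin n → Bool) → Set
  LocallyMaximal s = ∀ w → uncutDeg s w ≤ cutDeg s w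

  locallyMaximal-or-improvable :
    ∀ s → LocallyMaximal s ⊎ Σ (Fin n → Bool) (λ s′ → cutWeight s < cutWeight s′)
  locallyMaximal-or-improvable s with all? (λ w → uncutDeg s w ≤? cutDeg s w)
  ... | yes maximal = inj₁ maximal
  ... | no ¬maximal with ¬∀⟶∃¬ n _ (λ w → uncutDeg s w ≤? cutDeg s w) ¬maximal
  ...   | w , uncut≰cut = inj₂ (switch s w , switch-increases-cutWeight s w (≰⇒> uncut≰cut))

  locallyMaximalCut : Σ (Fin n → Bool) LocallyMaximal
  locallyMaximalCut = hill-climb cutWeight (n * n) cutWeight-≤ locallyMaximal-or-improvable (λ _ → false)

  cutGraph : (Fin n → Bool) → Graph n
  cutGraph s = record
    { adj    = crossing s
    ; sym    = λ u v → cong₂ _∧_ (Graph.sym G u v) (xor-comm (s u) (s v))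
    ; irrefl = λ v → cong (_∧ (s v xor s v)) (irrefl G v)
    }

  cutGraph-spanning : ∀ s → SpanningSubgraph (cutGraph s) G
  cutGraph-spanning s u v uv∈H with adj G u v
  ... | true = refl

  cutGraph-bipartite : ∀ s → Bipartite (cutGraph s)
  cutGraph-bipartite s = s , λ u v uv∈H su≡sv → contradiction (begin
    false                     ≡⟨ ∧-zeroʳ (adj G u v) ⟨
    adj G u v ∧ false         ≡⟨ cong (adj G u v ∧_) (xor-same (s v)) ⟨
    adj G u v ∧ (s v xor s v) ≡⟨ cong (λ b → adj G u v ∧ (b xor s v)) su≡sv ⟨
    crossing s u v            ≡⟨ uv∈H ⟩
    true                      ∎) λ ()
    where open ≡-Reasoning

  nbrs-split : ∀ s v → Interleaving (nbrs (cutGraph s) v) (filterᵇ (uncut s v) (allFin n)) (nbrs G v)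
  nbrs-split s v = filterᵇ-split (adj G v) (λ u → s v xor s u) (allFin n)

  deg-cutGraph : ∀ s v → deg (cutGraph s) v ≡ cutDeg s v
  deg-cutGraph s v = length-filterᵇ-tabulate (crossing s v) id

  deg-split : ∀ s v → deg G v ≡ cutDeg s v + uncutDeg s v
  deg-split s v = trans (interleave-length (nbrs-split s v))
    (cong₂ _+_ (deg-cutGraph s v) (length-filterᵇ-tabulate (uncut s v) id))

  colDeg-split : ∀ s C v → colDeg G C v ≤ colDeg (cutGraph s) C v + uncutDeg s v
  colDeg-split s C v = subst (colDeg G C v ≤_) (cong (colDeg (cutGraph s) C v +_) uncut-count)
    (distinct-interleaving ℕ._≟_ (map⁺ c c c (Interleaving.map (cong c) (cong c) (nbrs-split s v))))
    where
    c : Fin n → ℕ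
    c = col C v
    uncut-count : length (map c (filterᵇ (uncut s v) (allFin n))) ≡ uncutDeg s v
    uncut-count = trans (length-map c (filterᵇ (uncut s v) (allFin n))) (length-filterᵇ-tabulate (uncut s v) id)

  locallyMaximal-degrees : ∀ s → LocallyMaximal s → ∀ C v →
    colDeg G C v + deg G v ≤ 2 * colDeg (cutGraph s) C v + 3 * deg (cutGraph s) v
  locallyMaximal-degrees s maximal C v
    rewrite deg-split s v | deg-cutGraph s v = degree-arithmetic (colDeg-split s C v) (maximal v)

lemma7 : (n : ℕ) (G : Graph n) (C : EdgeColoring n) →
         Σ (Graph n) λ H → SpanningSubgraph H G × Bipartite H ×
           (∀ (v : Fin n) → colDeg G C v + deg G v ≤ 2 * colDeg H C v + 3 * deg H v)
lemma7 n G C = cutGraph s , cutGraph-spanning s , cutGraph-bipartite s , locallyMaximal-degrees s maximal C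
  where
  open Cut G
  s : Fin n → Bool
  s = proj₁ locallyMaximalCut
  maximal : LocallyMaximal s
  maximal = proj₂ locallyMaximalCut
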